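{- Every trigraph whose total graph is a subdivision of a subgraph of a grid has twin-width at most $4$.
   Context: The $n\times m$ grid has vertex set $[n]\times[m]$ and edges between $(x,y),(x+1,y)$ and between $(x,y),(x,y+1)$; a grid is an $n\times m$ grid for some $n,m$. A trigraph has a vertex set and disjoint sets of black and red edges; its total graph has all black and red edges as edges. Contracting distinct $u,v$ into a new vertex $z$ makes vertices adjacent (by any edge) to exactly one of $u,v$ red neighbours of $z$, a common neighbour $x$ a black neighbour if $ux,vx$ are both black and a red neighbour otherwise, other edges unchanged. A $d$-sequence of an $n$-vertex trigraph $G$ is a sequence $G=G_n,\dots,G_1$ of trigraphs of red degree at most $d$, each obtained from the previous by one contraction; the twin-width is the least $d$ for which one exists. -}

module Defs where

open import Data.Nat using (ℕ; zero; suc; _≤_)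
open import Data.Fin using (Fin; toℕ)
open import Data.List using (map; allFin)
open import Data.Nat.ListAction using (sum)
open import Data.Product using (Σ; _×_; _,_; proj₁; proj₂)
open import Data.Sum using (_⊎_; inj₁; inj₂)
open import Data.Empty using (⊥)
import Data.Nat.Properties
import Function.Bundles
import Relation.Binary.PropositionalEquality as ≡
open import Data.Maybe using (Maybe; just; nothing)
open import Relation.Binary.PropositionalEquality using (_≡_; _≢_)
open import Relation.Nullary using (¬_)
open import Function.Bundles using (_↔_)
open import Level using () renaming (suc to lsuc)

-- Trigraphs on the vertex set Fin k.
-- Every pair of vertices carries exactly one of: no edge, a black edge,
-- a red edge (so black and red edge sets are disjoint by construction).

data Colour : Set where
  none black red : Colour

record Trigraph (k : ℕ) : Set where
  field
    colour  : Fin k → Fin k → Colour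
    sym     : ∀ x y → colour x y ≡ colour y x
    irrefl  : ∀ x → colour x x ≡ none
open Trigraph public

redInd : Colour → ℕ
redInd red = 1
redInd _   = 0

redDeg : ∀ {k} → Trigraph k → Fin k → ℕ
redDeg {k} G x = sum (map (λ y → redInd (colour G x y)) (allFin k))

RedDeg≤ : ∀ {k} → ℕ → Trigraph k → Set
RedDeg≤ d G = ∀ x → redDeg G x ≤ d

-- colour of the edge z x after contracting u,v into z, given colours of ux, vx
merge : Colour → Colour → Colour
merge none  none  = none
merge black black = black
merge _     _     = red

-- H is obtained from G by contracting two distinct vertices u, v.
-- f identifies the vertices of G other than u, v with vertices of H
-- (bijectively), and sends both u and v to the new vertex z = f u.
record Contraction {n : ℕ} (G : Trigraph (suc n)) (H : Trigraph n) : Set where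
  field
    u v     : Fin (suc n)
    u≢v     : u ≢ v
    f       : Fin (suc n) → Fin n
    fu≡fv   : f u ≡ f v
    f-inj   : ∀ x y → x ≢ u → x ≢ v → f x ≡ f y → x ≡ y
    f-surj  : ∀ a → Σ (Fin (suc n)) (λ x → f x ≡ a)
    keep    : ∀ x y → x ≢ u → x ≢ v → y ≢ u → y ≢ v →
              colour H (f x) (f y) ≡ colour G x y
    new     : ∀ x → x ≢ u → x ≢ v →
              colour H (f u) (f x) ≡ merge (colour G u x) (colour G v x)

-- d-sequences G = G_k, ..., G_1 (every trigraph of red degree ≤ d,
-- each obtained from the previous one by one contraction).
-- Convention: the empty trigraph (k = 0) trivially has one.
data DSeq (d : ℕ) : (k : ℕ) → Trigraph k → Set where
  empty : (G : Trigraph 0) → DSeq d 0 G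
  last  : (G : Trigraph 1) → RedDeg≤ d G → DSeq d 1 G
  step  : ∀ {k} (G : Trigraph (suc (suc k))) (H : Trigraph (suc k)) →
          RedDeg≤ d G → Contraction G H → DSeq d (suc k) H →
          DSeq d (suc (suc k)) G

TwinWidth≤ : ∀ {k} → ℕ → Trigraph k → Set
TwinWidth≤ {k} d G = DSeq d k G

record Graph : Set₁ where
  field
    V    : Set
    E    : V → V → Set
    Esym : ∀ {a b} → E a b → E b a
    Eirr : ∀ {a} → ¬ E a a
open Graph public

totalGraph : ∀ {k} → Trigraph k → Graph
totalGraph {k} G = record
  { V = Fin k
  ; E = λ x y → colour G x y ≢ none
  ; Esym = λ {a} {b} p q → p (Relation.Binary.PropositionalEquality.trans (sym G a b) q)
  ; Eirr = λ {a} p → p (irrefl G a)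
  }

-- the n × m grid on [n] × [m] (here 0-indexed: Fin n × Fin m)
GridE : ∀ {n m} → Fin n × Fin m → Fin n × Fin m → Set
GridE (x , y) (x' , y') =
    (toℕ x' ≡ suc (toℕ x) × y ≡ y')
  ⊎ (toℕ x ≡ suc (toℕ x') × y ≡ y')
  ⊎ (x ≡ x' × toℕ y' ≡ suc (toℕ y))
  ⊎ (x ≡ x' × toℕ y ≡ suc (toℕ y'))


private
  n≢1+n : ∀ (k : ℕ) → ¬ (k ≡ suc k)
  n≢1+n zero ()
  n≢1+n (suc k) p = n≢1+n k (Data.Nat.Properties.suc-injective p)

  gridSym : ∀ {n m} {a b : Fin n × Fin m} → GridE a b → GridE b a
  gridSym (inj₁ (p , q))               = inj₂ (inj₁ (p , ≡.sym q))
  gridSym (inj₂ (inj₁ (p , q)))        = inj₁ (p , ≡.sym q)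
  gridSym (inj₂ (inj₂ (inj₁ (p , q)))) = inj₂ (inj₂ (inj₂ (≡.sym p , q)))
  gridSym (inj₂ (inj₂ (inj₂ (p , q)))) = inj₂ (inj₂ (inj₁ (≡.sym p , q)))

  gridIrr : ∀ {n m} {a : Fin n × Fin m} → ¬ GridE a a
  gridIrr {a = x , y} (inj₁ (p , _))               = n≢1+n (toℕ x) p
  gridIrr {a = x , y} (inj₂ (inj₁ (p , _)))        = n≢1+n (toℕ x) p
  gridIrr {a = x , y} (inj₂ (inj₂ (inj₁ (_ , p)))) = n≢1+n (toℕ y) p
  gridIrr {a = x , y} (inj₂ (inj₂ (inj₂ (_ , p)))) = n≢1+n (toℕ y) p

grid : ℕ → ℕ → Graph
grid n m = record
  { V = Fin n × Fin m ; E = GridE ; Esym = gridSym ; Eirr = gridIrr }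

record Subgraph (H G : Graph) : Set where
  field
    ι     : V H → V G
    ι-inj : ∀ a b → ι a ≡ ι b → a ≡ b
    ι-E   : ∀ {a b} → E H a b → E G (ι a) (ι b)

record Iso (G H : Graph) : Set where
  field
    bij : V G ↔ V H
  open Function.Bundles.Inverse bij public using (to)
  field
    to-E   : ∀ {a b} → E G a b → E H (to a) (to b)
    from-E : ∀ {a b} → E H (to a) (to b) → E G a b

-- elementary subdivision of the edge xy of T: a new vertex (nothing)
-- replaces the edge xy by the path x - new - y
module _ (T : Graph) (x y : V T) where
  private
    isXY : V T → V T → Set
    isXY a b = (a ≡ x × b ≡ y) ⊎ (a ≡ y × b ≡ x)

    isXYsym : ∀ {a b} → isXY a b → isXY b a
    isXYsym (inj₁ (p , q)) = inj₂ (q , p)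
    isXYsym (inj₂ (p , q)) = inj₁ (q , p)

    E' : Maybe (V T) → Maybe (V T) → Set
    E' (just a) (just b) = E T a b × ¬ isXY a b
    E' nothing  (just a) = a ≡ x ⊎ a ≡ y
    E' (just a) nothing  = a ≡ x ⊎ a ≡ y
    E' nothing  nothing  = ⊥

    E'sym : ∀ {a b} → E' a b → E' b a
    E'sym {just a} {just b} (e , ne) = Esym T e , λ h → ne (isXYsym h)
    E'sym {nothing} {just a} p = p
    E'sym {just a} {nothing} p = p

    E'irr : ∀ {a} → ¬ E' a a
    E'irr {just a} (e , _) = Eirr T e

  subdivideEdge : Graph
  subdivideEdge = record { V = Maybe (V T) ; E = E' ; Esym = E'sym ; Eirr = λ {a} → E'irr {a} }

data Subdivision : Graph → Graph → Set₁ where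
  refl-sub : ∀ H → Subdivision H H
  step-sub : ∀ {S H} (x y : V S) → E S x y →
             Subdivision S H → Subdivision (subdivideEdge S x y) H

SubdivOfSubgraphOfGrid : Graph → Set₁
SubdivOfSubgraphOfGrid G =
  Σ ℕ λ n → Σ ℕ λ m → Σ Graph λ H → Σ Graph λ S →
    Subgraph H (grid n m) × Subdivision S H × Iso G S

{-# OPTIONS --safe #-}
module Submission where

-- A trigraph whose total graph embeds into a graph in which every vertex has at most d
-- neighbours has red degree at most d.  If that host graph can be folded down to a single
-- vertex by maps that each identify at most one pair of vertices and send edges to edges or
-- loops, then contracting the two vertices of the trigraph lying over the identified pair keeps
-- the total graph embedded in the next host, which yields a d-sequence.  Subdividing an edge xy
-- is undone by folding the new vertex onto x and creates a vertex of degree 2 only.  The n × m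
-- grid is folded column by column, each cell of a column onto its right neighbour from the
-- bottom up; every intermediate host is a region of the grid plus one diagonal edge and still
-- has maximum degree 4, and the last column, read as the row of the m × 1 grid, is folded by
-- the same stages.

open import Defs renaming (sym to colour-sym)
open import Data.Nat using (ℕ; zero; suc; pred; _≤_; _<_; z≤n; s≤s; _+_; _∸_)
import Data.Nat.Properties as ℕ
open import Data.Nat.Properties using (m∸n+n≡m; m≤n+m; +-suc)
open import Data.Nat.ListAction using (sum)
open import Data.Fin using (Fin; zero; suc; toℕ; punchIn; punchOut)
import Data.Fin.Properties as Fin
open import Data.Fin.Properties
  using (_≟_; any?; punchOut-cong; punchOut-punchIn; punchIn-punchOut; punchInᵢ≢i)
open import Data.List using (List; []; _∷_; length; map; tabulate)
open import Data.List.Properties using (map-tabulate; length-map; length-removeAt′)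
open import Data.List.Membership.Propositional using (_∈_)
open import Data.List.Membership.Propositional.Properties using (∈-map⁺)
open import Data.List.Relation.Unary.Any using (here; there; index; _─_)
open import Data.Product using (Σ; ∃; ∃₂; _×_; _,_; proj₁; proj₂)
import Data.Product.Properties as ×
open import Data.Sum using (_⊎_; inj₁; inj₂)
import Data.Sum as Sum
open import Data.Empty using (⊥-elim)
open import Data.Unit using (⊤; tt)
open import Data.Maybe using (Maybe; just; nothing)
import Data.Maybe.Properties as Maybe
open import Function using (_∘_; id)
open import Function.Bundles using (Injection)
open import Function.Properties.Inverse using (↔⇒↣)
open import Relation.Binary.Definitions using (DecidableEquality)
open import Relation.Binary.PropositionalEquality
  using (_≡_; _≢_; refl; sym; trans; cong; cong₂; subst; subst₂; module ≡-Reasoning)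
open import Relation.Nullary using (¬_; Dec; yes; no)
open import Relation.Nullary.Decidable using (map′; ¬?; _×-dec_; _⊎-dec_; decidable-stable)

module _ {A : Set} where

  ∈-─ : ∀ {L} {x z : A} (x∈L : x ∈ L) → z ∈ L → z ≢ x → z ∈ (L ─ x∈L)
  ∈-─ (here refl) (here refl) z≢x = ⊥-elim (z≢x refl)
  ∈-─ (here _)    (there z∈L) _   = z∈L
  ∈-─ (there _)   (here z≡y)  _   = here z≡y
  ∈-─ (there x∈L) (there z∈L) z≢x = there (∈-─ x∈L z∈L z≢x)

  sum-tabulate≤length : ∀ {k L} (w : Fin k → ℕ) (τ : Fin k → A) →
    (∀ {x y} → τ x ≡ τ y → x ≡ y) →
    (∀ y → w y ≡ 0 ⊎ (w y ≡ 1 × τ y ∈ L)) →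
    sum (tabulate w) ≤ length L
  sum-tabulate≤length {zero}  _ _ _ _ = z≤n
  sum-tabulate≤length {suc k} {L} w τ τ-inj support with support zero
  ... | inj₁ w₀≡0 rewrite w₀≡0 =
    sum-tabulate≤length (w ∘ suc) (τ ∘ suc) (Fin.suc-injective ∘ τ-inj) (support ∘ suc)
  ... | inj₂ (w₀≡1 , τ₀∈L) rewrite w₀≡1 | length-removeAt′ L (index τ₀∈L) =
    s≤s (sum-tabulate≤length (w ∘ suc) (τ ∘ suc) (Fin.suc-injective ∘ τ-inj) support′)
    where
    support′ : ∀ y → w (suc y) ≡ 0 ⊎ (w (suc y) ≡ 1 × τ (suc y) ∈ (L ─ τ₀∈L))
    support′ y with support (suc y)
    ... | inj₁ w≡0 = inj₁ w≡0
    ... | inj₂ (w≡1 , τ∈L) = inj₂ (w≡1 , ∈-─ τ₀∈L τ∈L (Fin.0≢1+n ∘ τ-inj ∘ sym))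

-- Neighbours are listed by code rather than as vertices: the vertices of a subgraph of the
-- grid cannot be enumerated, but their cells can.
record BoundedDegree (d : ℕ) {V : Set} (Alive : V → Set) (_~_ : V → V → Set) : Set₁ where
  field
    Code                : Set
    _≟ᶜ_                : DecidableEquality Code
    code                : V → Code
    code-injective      : ∀ {a b} → code a ≡ code b → a ≡ b
    neighbours          : V → List Code
    neighbours-length   : ∀ a → length (neighbours a) ≤ d
    neighbours-complete : ∀ {a b} → Alive a → Alive b → a ~ b → code b ∈ neighbours a

  _≟ᵛ_ : DecidableEquality V
  a ≟ᵛ b = map′ code-injective (cong code) (code a ≟ᶜ code b)

record Host (d : ℕ) : Set₁ where
  field
    Vertex   : Set
    Alive    : Vertex → Set
    Adjacent : Vertex → Vertex → Set
    bounded  : BoundedDegree d Alive Adjacent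
  open BoundedDegree bounded public
open Host public using (Vertex; Alive; Adjacent)

record Embedding {d k : ℕ} (M : Host d) (G : Trigraph k) : Set where
  field
    embed     : Fin k → Vertex M
    alive     : ∀ x → Alive M (embed x)
    injective : ∀ {x y} → embed x ≡ embed y → x ≡ y
    adjacent  : ∀ {x y} → colour G x y ≢ none → Adjacent M (embed x) (embed y)

redInd-cases : ∀ c → redInd c ≡ 0 ⊎ (redInd c ≡ 1 × c ≢ none)
redInd-cases none  = inj₁ refl
redInd-cases black = inj₁ refl
redInd-cases red   = inj₂ (refl , λ ())

embedding⇒redDeg≤ : ∀ {d k} {M : Host d} {G : Trigraph k} → Embedding M G → RedDeg≤ d G
embedding⇒redDeg≤ {d} {k} {M} {G} e x = begin
  redDeg G x                                        ≡⟨ cong sum (map-tabulate id redIndAt) ⟩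
  sum (tabulate redIndAt)                           ≤⟨ sum-tabulate≤length redIndAt (code ∘ embed)
                                                         (injective ∘ code-injective) support ⟩
  length (neighbours (embed x))                     ≤⟨ neighbours-length (embed x) ⟩
  d                                                 ∎
  where
  open Host M using (code; code-injective; neighbours; neighbours-length; neighbours-complete)
  open Embedding e
  open ℕ.≤-Reasoning

  redIndAt : Fin k → ℕ
  redIndAt y = redInd (colour G x y)

  support : ∀ y → redIndAt y ≡ 0 ⊎ (redIndAt y ≡ 1 × code (embed y) ∈ neighbours (embed x))
  support y with redInd-cases (colour G x y)
  ... | inj₁ w≡0 = inj₁ w≡0
  ... | inj₂ (w≡1 , edge) = inj₂ (w≡1 , neighbours-complete (alive x) (alive y) (adjacent edge))

-- Contracting two vertices of a trigraph

merge≢none : ∀ c c′ → merge c c′ ≢ none → c ≢ none ⊎ c′ ≢ none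
merge≢none none  none  h = ⊥-elim (h refl)
merge≢none none  black _ = inj₂ (λ ())
merge≢none none  red   _ = inj₂ (λ ())
merge≢none black _     _ = inj₁ (λ ())
merge≢none red   _     _ = inj₁ (λ ())

module _ {n : ℕ} (G : Trigraph (suc n)) {u v : Fin (suc n)} (u≢v : u ≢ v) where

  -- u plays the role of the new vertex; v is then removed by renumbering with punchIn v.
  mergedColour : Fin (suc n) → Fin (suc n) → Colour
  mergedColour x y with x ≟ u | y ≟ u
  ... | yes _ | yes _ = none
  ... | yes _ | no _  = merge (colour G u y) (colour G v y)
  ... | no _  | yes _ = merge (colour G u x) (colour G v x)
  ... | no _  | no _  = colour G x y

  mergedColour-sym : ∀ x y → mergedColour x y ≡ mergedColour y x
  mergedColour-sym x y with x ≟ u | y ≟ u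
  ... | yes _ | yes _ = refl
  ... | yes _ | no _  = refl
  ... | no _  | yes _ = refl
  ... | no _  | no _  = colour-sym G x y

  mergedColour-irrefl : ∀ x → mergedColour x x ≡ none
  mergedColour-irrefl x with x ≟ u
  ... | yes _ = refl
  ... | no _  = irrefl G x

  mergedColour-new : ∀ y → y ≢ u → mergedColour u y ≡ merge (colour G u y) (colour G v y)
  mergedColour-new y y≢u with u ≟ u | y ≟ u
  ... | no u≢u | _      = ⊥-elim (u≢u refl)
  ... | yes _  | yes y≡u = ⊥-elim (y≢u y≡u)
  ... | yes _  | no _    = refl

  mergedColour-keep : ∀ x y → x ≢ u → y ≢ u → mergedColour x y ≡ colour G x y
  mergedColour-keep x y x≢u y≢u with x ≟ u | y ≟ u
  ... | yes x≡u | _       = ⊥-elim (x≢u x≡u)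
  ... | no _    | yes y≡u = ⊥-elim (y≢u y≡u)
  ... | no _    | no _    = refl

  contract : Trigraph n
  contract = record
    { colour = λ a b → mergedColour (punchIn v a) (punchIn v b)
    ; sym    = λ a b → mergedColour-sym (punchIn v a) (punchIn v b)
    ; irrefl = λ a → mergedColour-irrefl (punchIn v a) }

  squash : Fin (suc n) → Fin n
  squash x with x ≟ v
  ... | yes _   = punchOut (u≢v ∘ sym)
  ... | no x≢v  = punchOut (x≢v ∘ sym)

  squash-≢v : ∀ {x} (x≢v : x ≢ v) → squash x ≡ punchOut (x≢v ∘ sym)
  squash-≢v {x} x≢v with x ≟ v
  ... | yes x≡v = ⊥-elim (x≢v x≡v)
  ... | no _    = punchOut-cong v refl

  squash-v : squash v ≡ squash u
  squash-v with v ≟ v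
  ... | no v≢v = ⊥-elim (v≢v refl)
  ... | yes _  = sym (squash-≢v u≢v)

  punchIn-squash : ∀ {x} → x ≢ v → punchIn v (squash x) ≡ x
  punchIn-squash x≢v = trans (cong (punchIn v) (squash-≢v x≢v)) (punchIn-punchOut _)

  squash-punchIn : ∀ a → squash (punchIn v a) ≡ a
  squash-punchIn a =
    trans (squash-≢v (punchInᵢ≢i v a)) (trans (punchOut-cong v refl) (punchOut-punchIn v))

  squash-injective : ∀ x y → x ≢ u → x ≢ v → squash x ≡ squash y → x ≡ y
  squash-injective x y x≢u x≢v eq = by-cases (y ≟ v)
    where
    open ≡-Reasoning
    x≡punchIn : x ≡ punchIn v (squash y)
    x≡punchIn = trans (sym (punchIn-squash x≢v)) (cong (punchIn v) eq)

    by-cases : Dec (y ≡ v) → x ≡ y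
    by-cases (no y≢v)    = trans x≡punchIn (punchIn-squash y≢v)
    by-cases (yes refl)  = ⊥-elim (x≢u (begin
      x                       ≡⟨ x≡punchIn ⟩
      punchIn v (squash v)    ≡⟨ cong (punchIn v) squash-v ⟩
      punchIn v (squash u)    ≡⟨ punchIn-squash u≢v ⟩
      u                       ∎))

  contraction : Contraction G contract
  contraction = record
    { u = u ; v = v ; u≢v = u≢v ; f = squash ; fu≡fv = sym squash-v
    ; f-inj  = squash-injective
    ; f-surj = λ a → punchIn v a , squash-punchIn a
    ; keep   = λ x y x≢u x≢v y≢u y≢v →
        trans (cong₂ mergedColour (punchIn-squash x≢v) (punchIn-squash y≢v))
              (mergedColour-keep x y x≢u y≢u)
    ; new    = λ x x≢u x≢v →
        trans (cong₂ mergedColour (punchIn-squash u≢v) (punchIn-squash x≢v))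
              (mergedColour-new x x≢u) }

module ContractionProperties {n : ℕ} {G : Trigraph (suc n)} {H : Trigraph n} (c : Contraction G H) where
  open Contraction c

  Merged : Fin (suc n) → Set
  Merged x = x ≡ u ⊎ x ≡ v

  merged? : ∀ x → Merged x ⊎ (x ≢ u × x ≢ v)
  merged? x with x ≟ u | x ≟ v
  ... | yes x≡u | _       = inj₁ (inj₁ x≡u)
  ... | no _    | yes x≡v = inj₁ (inj₂ x≡v)
  ... | no x≢u  | no x≢v  = inj₂ (x≢u , x≢v)

  f-merged : ∀ {x} → Merged x → f x ≡ f u
  f-merged (inj₁ refl) = refl
  f-merged (inj₂ refl) = sym fu≡fv

  f-both-merged : ∀ {x y} → Merged x → Merged y → f x ≡ f y
  f-both-merged x-merged y-merged = trans (f-merged x-merged) (sym (f-merged y-merged))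

  f-fibre : ∀ {x y} → f x ≡ f y → x ≡ y ⊎ (Merged x × Merged y)
  f-fibre {x} {y} eq with merged? x | merged? y
  ... | inj₂ (x≢u , x≢v) | _                = inj₁ (f-inj x y x≢u x≢v eq)
  ... | inj₁ _           | inj₂ (y≢u , y≢v) = inj₁ (sym (f-inj y x y≢u y≢v (sym eq)))
  ... | inj₁ x-merged    | inj₁ y-merged    = inj₂ (x-merged , y-merged)

  private
    edge-from-merged : ∀ {x₀} y → Merged x₀ → y ≢ u → y ≢ v →
      colour H (f x₀) (f y) ≢ none →
      ∃ λ x → Merged x × colour G x y ≢ none
    edge-from-merged y x₀-merged y≢u y≢v h
      with merge≢none _ _ (h ∘ trans (trans (cong (λ a → colour H a (f y)) (f-merged x₀-merged))
                                            (new y y≢u y≢v)))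
    ... | inj₁ uy = u , inj₁ refl , uy
    ... | inj₂ vy = v , inj₂ refl , vy

    lift : ∀ x₀ y₀ → colour H (f x₀) (f y₀) ≢ none →
      ∃₂ λ x y → f x ≡ f x₀ × f y ≡ f y₀ × colour G x y ≢ none
    lift x₀ y₀ h with merged? x₀ | merged? y₀
    ... | inj₂ (x₀≢u , x₀≢v) | inj₂ (y₀≢u , y₀≢v) =
      x₀ , y₀ , refl , refl , h ∘ trans (keep x₀ y₀ x₀≢u x₀≢v y₀≢u y₀≢v)
    ... | inj₁ x₀-merged | inj₂ (y₀≢u , y₀≢v) =
      let x , x-merged , xy = edge-from-merged y₀ x₀-merged y₀≢u y₀≢v h
      in x , y₀ , f-both-merged x-merged x₀-merged , refl , xy
    ... | inj₂ (x₀≢u , x₀≢v) | inj₁ y₀-merged =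
      let y , y-merged , yx = edge-from-merged x₀ y₀-merged x₀≢u x₀≢v (h ∘ trans (colour-sym H _ _))
      in x₀ , y , refl , f-both-merged y-merged y₀-merged , yx ∘ trans (colour-sym G y x₀)
    ... | inj₁ x₀-merged | inj₁ y₀-merged =
      ⊥-elim (h (subst (λ a → colour H (f x₀) a ≡ none)
                       (f-both-merged x₀-merged y₀-merged) (irrefl H (f x₀))))

  edge-lift : ∀ {a b} → colour H a b ≢ none →
    ∃₂ λ x y → f x ≡ a × f y ≡ b × colour G x y ≢ none
  edge-lift {a} {b} h with f-surj a | f-surj b
  ... | x₀ , refl | y₀ , refl = lift x₀ y₀ h

-- Foldings of hosts and d-sequences

SamePair : {A : Set} → A → A → A → A → Set
SamePair a b c e = (a ≡ c × b ≡ e) ⊎ (a ≡ e × b ≡ c)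

SamePair-via : ∀ {A : Set} {a b c e p q : A} → SamePair a b p q → SamePair c e p q → SamePair a b c e
SamePair-via (inj₁ (refl , refl)) (inj₁ (refl , refl)) = inj₁ (refl , refl)
SamePair-via (inj₁ (refl , refl)) (inj₂ (refl , refl)) = inj₂ (refl , refl)
SamePair-via (inj₂ (refl , refl)) (inj₁ (refl , refl)) = inj₂ (refl , refl)
SamePair-via (inj₂ (refl , refl)) (inj₂ (refl , refl)) = inj₁ (refl , refl)

record Folding {d : ℕ} (M M′ : Host d) : Set where
  field
    fold          : Vertex M → Vertex M′
    fold-alive    : ∀ {a} → Alive M a → Alive M′ (fold a)
    fold-adjacent : ∀ {a b} → Alive M a → Alive M b → Adjacent M a b →
                    Adjacent M′ (fold a) (fold b) ⊎ fold a ≡ fold b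
    fold-merges-at-most-one-pair : ∀ {a b c e} →
      Alive M a → Alive M b → Alive M c → Alive M e →
      a ≢ b → fold a ≡ fold b → c ≢ e → fold c ≡ fold e → SamePair a b c e

data FoldingSequence {d : ℕ} : Host d → Set₁ where
  end : ∀ {M} → (∀ {a b} → Alive M a → Alive M b → a ≡ b) → FoldingSequence M
  _∷_ : ∀ {M M′} → Folding M M′ → FoldingSequence M′ → FoldingSequence M

module _ {d : ℕ} {M M′ : Host d} (F : Folding M M′) where
  open Folding F

  module _ {k : ℕ} {G : Trigraph k} (e : Embedding M G) where
    open Embedding e

    folded : Fin k → Vertex M′
    folded = fold ∘ embed

    folded-adjacent : ∀ {x y} → colour G x y ≢ none →
      Adjacent M′ (folded x) (folded y) ⊎ folded x ≡ folded y
    folded-adjacent h = fold-adjacent (alive _) (alive _) (adjacent h)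

    colour≢none⇒≢ : ∀ {x y} → colour G x y ≢ none → x ≢ y
    colour≢none⇒≢ {x} h refl = h (irrefl G x)

    merged-pair? : Dec (∃₂ λ x y → x ≢ y × folded x ≡ folded y)
    merged-pair? = any? λ x → any? λ y → ¬? (x ≟ y) ×-dec (folded x ≟ᵛ folded y)
      where open Host M′ using (_≟ᵛ_)

    fold-embedding : (∀ {x y} → x ≢ y → folded x ≢ folded y) → Embedding M′ G
    fold-embedding no-merge = record
      { embed     = folded
      ; alive     = fold-alive ∘ alive
      ; injective = λ {x} {y} eq → decidable-stable (x ≟ y) (λ x≢y → no-merge x≢y eq)
      ; adjacent  = adjacent′ }
      where
      adjacent′ : ∀ {x y} → colour G x y ≢ none → Adjacent M′ (folded x) (folded y)
      adjacent′ h with folded-adjacent h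
      ... | inj₁ adj = adj
      ... | inj₂ eq  = ⊥-elim (no-merge (colour≢none⇒≢ h) eq)

  module _ {n : ℕ} {G : Trigraph (suc n)} {H : Trigraph n} (e : Embedding M G) (c : Contraction G H) where
    open Embedding e
    open Contraction c
    open ContractionProperties c

    module _ (uv-merged : folded e u ≡ folded e v) where

      folded-merged : ∀ {x} → Merged x → folded e x ≡ folded e u
      folded-merged (inj₁ refl) = refl
      folded-merged (inj₂ refl) = sym uv-merged

      only-uv-merged : ∀ {x y} → x ≢ y → folded e x ≡ folded e y → Merged x × Merged y
      only-uv-merged x≢y xy-merged
        with fold-merges-at-most-one-pair (alive _) (alive _) (alive _) (alive _)
               (x≢y ∘ injective) xy-merged (u≢v ∘ injective) uv-merged
      ... | inj₁ (xu , yv) = inj₁ (injective xu) , inj₂ (injective yv)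
      ... | inj₂ (xv , yu) = inj₂ (injective xv) , inj₁ (injective yu)

      folded-respects-f : ∀ {x y} → f x ≡ f y → folded e x ≡ folded e y
      folded-respects-f eq with f-fibre eq
      ... | inj₁ refl = refl
      ... | inj₂ (x-merged , y-merged) = trans (folded-merged x-merged) (sym (folded-merged y-merged))

      f-respects-folded : ∀ {x y} → folded e x ≡ folded e y → f x ≡ f y
      f-respects-folded {x} {y} eq with x ≟ y
      ... | yes refl = refl
      ... | no x≢y   = let x-merged , y-merged = only-uv-merged x≢y eq
                       in f-both-merged x-merged y-merged

      fold-contraction : Embedding M′ H
      fold-contraction = record
        { embed     = folded e ∘ preimage
        ; alive     = fold-alive ∘ alive ∘ preimage
        ; injective = λ {a} {b} eq →
            trans (sym (f-preimage a)) (trans (f-respects-folded eq) (f-preimage b))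
        ; adjacent  = adjacent′ }
        where
        preimage : Fin n → Fin (suc n)
        preimage a = proj₁ (f-surj a)

        f-preimage : ∀ a → f (preimage a) ≡ a
        f-preimage a = proj₂ (f-surj a)

        adjacent′ : ∀ {a b} → colour H a b ≢ none →
          Adjacent M′ (folded e (preimage a)) (folded e (preimage b))
        adjacent′ {a} {b} h with edge-lift h
        ... | x , y , refl , refl , xy with folded-adjacent e xy
        ...   | inj₁ adj = subst₂ (Adjacent M′)
                             (folded-respects-f (sym (f-preimage (f x))))
                             (folded-respects-f (sym (f-preimage (f y)))) adj
        ...   | inj₂ eq  = ⊥-elim (h (subst (λ b → colour H (f x) b ≡ none)
                                            (f-respects-folded eq) (irrefl H (f x))))

dSequence : ∀ {d} {M : Host d} → FoldingSequence M →
  ∀ {k} {G : Trigraph k} → Embedding M G → DSeq d k G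
dSequence _        {zero}        {G} _ = empty G
dSequence _        {suc zero}    {G} e = last G (embedding⇒redDeg≤ e)
dSequence (end single) {suc (suc _)} e =
  ⊥-elim (Fin.0≢1+n (injective (single (alive zero) (alive (suc zero)))))
  where open Embedding e
dSequence (F ∷ s) {suc (suc _)} {G} e with merged-pair? F e
... | yes (u , v , u≢v , uv-merged) =
  step G (contract G u≢v) (embedding⇒redDeg≤ e) (contraction G u≢v)
    (dSequence s (fold-contraction F e (contraction G u≢v) uv-merged))
... | no no-merge =
  dSequence s (fold-embedding F e λ x≢y xy-merged → no-merge (_ , _ , x≢y , xy-merged))

-- Subdividing an edge

graphHost : ∀ {d} (Γ : Graph) → BoundedDegree d (λ _ → ⊤) (E Γ) → Host d
graphHost Γ bound = record { Vertex = V Γ ; Alive = λ _ → ⊤ ; Adjacent = E Γ ; bounded = bound }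

module _ {d : ℕ} (2≤d : 2 ≤ d) {Γ : Graph} (bound : BoundedDegree d (λ _ → ⊤) (E Γ))
         {x y : V Γ} (xy : E Γ x y) where
  open BoundedDegree bound

  private
    Γ′ : Graph
    Γ′ = subdivideEdge Γ x y

    OnEdge : V Γ → Code → Set
    OnEdge a w = (a ≡ x × w ≡ code y) ⊎ (a ≡ y × w ≡ code x)

    onEdge? : ∀ a w → Dec (OnEdge a w)
    onEdge? a w = (a ≟ᵛ x ×-dec w ≟ᶜ code y) ⊎-dec (a ≟ᵛ y ×-dec w ≟ᶜ code x)

    -- in Γ′ the far end of xy is replaced by the new vertex, whose code is nothing
    reroute : V Γ → Code → Maybe Code
    reroute a w with onEdge? a w
    ... | yes _ = nothing
    ... | no _  = just w

    reroute-on : ∀ {a w} → OnEdge a w → reroute a w ≡ nothing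
    reroute-on {a} {w} on with onEdge? a w
    ... | yes _  = refl
    ... | no off = ⊥-elim (off on)

    reroute-off : ∀ {a b} → ¬ ((a ≡ x × b ≡ y) ⊎ (a ≡ y × b ≡ x)) →
      reroute a (code b) ≡ just (code b)
    reroute-off {a} {b} off with onEdge? a (code b)
    ... | no _                   = refl
    ... | yes (inj₁ (a≡x , b≡y)) = ⊥-elim (off (inj₁ (a≡x , code-injective b≡y)))
    ... | yes (inj₂ (a≡y , b≡x)) = ⊥-elim (off (inj₂ (a≡y , code-injective b≡x)))

    code′ : V Γ′ → Maybe Code
    code′ nothing  = nothing
    code′ (just a) = just (code a)

    code′-injective : ∀ {a b} → code′ a ≡ code′ b → a ≡ b
    code′-injective {nothing} {nothing} _  = refl
    code′-injective {just a}  {just b}  eq = cong just (code-injective (Maybe.just-injective eq))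

    neighbours′ : V Γ′ → List (Maybe Code)
    neighbours′ nothing  = just (code x) ∷ just (code y) ∷ []
    neighbours′ (just a) = map (reroute a) (neighbours a)

    neighbours′-length : ∀ a → length (neighbours′ a) ≤ d
    neighbours′-length nothing  = 2≤d
    neighbours′-length (just a) =
      subst (_≤ d) (sym (length-map (reroute a) (neighbours a))) (neighbours-length a)

    neighbours′-complete : ∀ {a b} → E Γ′ a b → code′ b ∈ neighbours′ a
    neighbours′-complete {nothing} {just _} (inj₁ refl) = here refl
    neighbours′-complete {nothing} {just _} (inj₂ refl) = there (here refl)
    neighbours′-complete {just _} {nothing} (inj₁ refl) =
      subst (_∈ neighbours′ (just x)) (reroute-on (inj₁ (refl , refl)))
            (∈-map⁺ (reroute x) (neighbours-complete tt tt xy))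
    neighbours′-complete {just _} {nothing} (inj₂ refl) =
      subst (_∈ neighbours′ (just y)) (reroute-on (inj₂ (refl , refl)))
            (∈-map⁺ (reroute y) (neighbours-complete tt tt (Esym Γ xy)))
    neighbours′-complete {just a} {just b} (ab , off) =
      subst (_∈ neighbours′ (just a)) (reroute-off off)
            (∈-map⁺ (reroute a) (neighbours-complete tt tt ab))

  subdivisionBound : BoundedDegree d (λ _ → ⊤) (E Γ′)
  subdivisionBound = record
    { Code = Maybe Code ; _≟ᶜ_ = Maybe.≡-dec _≟ᶜ_
    ; code = code′ ; code-injective = code′-injective
    ; neighbours = neighbours′ ; neighbours-length = neighbours′-length
    ; neighbours-complete = λ _ _ → neighbours′-complete }

  private
    unsubdivide : V Γ′ → V Γ
    unsubdivide nothing  = x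
    unsubdivide (just a) = a

    unsubdivide-adjacent : ∀ {a b} → E Γ′ a b →
      E Γ (unsubdivide a) (unsubdivide b) ⊎ unsubdivide a ≡ unsubdivide b
    unsubdivide-adjacent {nothing} {just _} (inj₁ refl) = inj₂ refl
    unsubdivide-adjacent {nothing} {just _} (inj₂ refl) = inj₁ xy
    unsubdivide-adjacent {just _} {nothing} (inj₁ refl) = inj₂ refl
    unsubdivide-adjacent {just _} {nothing} (inj₂ refl) = inj₁ (Esym Γ xy)
    unsubdivide-adjacent {just _} {just _}  (ab , _)    = inj₁ ab

    unsubdivide-merges : ∀ {a b} → a ≢ b → unsubdivide a ≡ unsubdivide b →
      SamePair a b nothing (just x)
    unsubdivide-merges {nothing} {nothing} a≢b _  = ⊥-elim (a≢b refl)
    unsubdivide-merges {nothing} {just _}  _ refl = inj₁ (refl , refl)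
    unsubdivide-merges {just _}  {nothing} _ refl = inj₂ (refl , refl)
    unsubdivide-merges {just _}  {just _}  a≢b eq = ⊥-elim (a≢b (cong just eq))

  unsubdivision : Folding (graphHost Γ′ subdivisionBound) (graphHost Γ bound)
  unsubdivision = record
    { fold          = unsubdivide
    ; fold-alive    = λ _ → tt
    ; fold-adjacent = λ _ _ → unsubdivide-adjacent
    ; fold-merges-at-most-one-pair = λ _ _ _ _ a≢b ab c≢e ce →
        SamePair-via (unsubdivide-merges a≢b ab) (unsubdivide-merges c≢e ce) }

subdivisionSequence : ∀ {d} → 2 ≤ d → ∀ {S Γ} → Subdivision S Γ →
  (bound : BoundedDegree d (λ _ → ⊤) (E Γ)) → FoldingSequence (graphHost Γ bound) →
  Σ (BoundedDegree d (λ _ → ⊤) (E S)) λ bound′ → FoldingSequence (graphHost S bound′)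
subdivisionSequence 2≤d (refl-sub _) bound seq = bound , seq
subdivisionSequence 2≤d (step-sub x y xy sub) bound seq =
  let bound′ , seq′ = subdivisionSequence 2≤d sub bound seq
  in subdivisionBound 2≤d bound′ xy , unsubdivision 2≤d bound′ xy ∷ seq′

-- Folding the grid

descend : ∀ {ℓ} (P : ℕ → Set ℓ) {m} → P m → (∀ {j} → j < m → P (suc j) → P j) →
  ∀ {j} → j ≤ m → P j
descend P {m} top lower {j} j≤m = go (m ∸ j) (m∸n+n≡m j≤m)
  where
  go : ∀ r {j} → r + j ≡ m → P j
  go zero    refl = top
  go (suc r) {j} r+j≡m =
    lower (subst (suc j ≤_) r+j≡m (s≤s (m≤n+m j r))) (go r (trans (+-suc r j) r+j≡m))

Cell : Set
Cell = ℕ × ℕ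

data GridAdjacent : Cell → Cell → Set where
  right : ∀ {a y} → GridAdjacent (a , y) (suc a , y)
  left  : ∀ {a y} → GridAdjacent (suc a , y) (a , y)
  up    : ∀ {a y} → GridAdjacent (a , y) (a , suc y)
  down  : ∀ {a y} → GridAdjacent (a , suc y) (a , y)

gridNeighbours : Cell → List Cell
gridNeighbours (a , y) = (suc a , y) ∷ (a ∸ 1 , y) ∷ (a , suc y) ∷ (a , y ∸ 1) ∷ []

gridNeighbours-complete : ∀ {p q} → GridAdjacent p q → q ∈ gridNeighbours p
gridNeighbours-complete right = here refl
gridNeighbours-complete left  = there (here refl)
gridNeighbours-complete up    = there (there (here refl))
gridNeighbours-complete down  = there (there (there (here refl)))

_≟²_ : DecidableEquality Cell
_≟²_ = ×.≡-dec ℕ._≟_ ℕ._≟_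

-- What is left at stage (i , j) of folding the grid column by column onto the next column: all
-- columns before i and the cells (i , y) with y < j are gone.
Region : ℕ → ℕ → Cell → Set
Region i j (a , y) = (y < j × i < a) ⊎ (j ≤ y × i ≤ a)

Region⇒≤ : ∀ {i j a y} → Region i j (a , y) → i ≤ a
Region⇒≤ (inj₁ (_ , i<a)) = ℕ.<⇒≤ i<a
Region⇒≤ (inj₂ (_ , i≤a)) = i≤a

Region-column : ∀ {i j y} → Region i j (i , y) → j ≤ y
Region-column {i} (inj₁ (_ , i<i)) = ⊥-elim (ℕ.n≮n i i<i)
Region-column     (inj₂ (j≤y , _)) = j≤y

-- Merging (i , y) into (i + 1 , y) joins (i + 1 , y) to (i , y + 1).
data Diagonal (i : ℕ) : ℕ → Cell → Cell → Set where
  diag  : ∀ {y} → Diagonal i (suc y) (suc i , y) (i , suc y)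
  diag⁻ : ∀ {y} → Diagonal i (suc y) (i , suc y) (suc i , y)

StageAdjacent : ℕ → ℕ → Cell → Cell → Set
StageAdjacent i j p q = GridAdjacent p q ⊎ Diagonal i j p q

GridAdjacent-sym : ∀ {p q} → GridAdjacent p q → GridAdjacent q p
GridAdjacent-sym right = left
GridAdjacent-sym left  = right
GridAdjacent-sym up    = down
GridAdjacent-sym down  = up

StageAdjacent-sym : ∀ {i j p q} → StageAdjacent i j p q → StageAdjacent i j q p
StageAdjacent-sym (inj₁ pq)    = inj₁ (GridAdjacent-sym pq)
StageAdjacent-sym (inj₂ diag)  = inj₂ diag⁻
StageAdjacent-sym (inj₂ diag⁻) = inj₂ diag

-- The diagonal partner of a cell takes the slot of a grid neighbour that is gone.
leftSlot : ℕ → ℕ → Cell → Cell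
leftSlot i j (a , y) with (a , suc y) ≟² (suc i , j)
... | yes _ = (i , j)
... | no _  = (a ∸ 1 , y)

downSlot : ℕ → ℕ → Cell → Cell
downSlot i j (a , y) with (a , y) ≟² (i , j)
... | yes _ = (suc i , j ∸ 1)
... | no _  = (a , y ∸ 1)

stageNeighbours : ℕ → ℕ → Cell → List Cell
stageNeighbours i j (a , y) =
  (suc a , y) ∷ leftSlot i j (a , y) ∷ (a , suc y) ∷ downSlot i j (a , y) ∷ []

stageNeighbours-complete : ∀ {i j p q} → Region i j q → StageAdjacent i j p q →
  q ∈ stageNeighbours i j p
stageNeighbours-complete _ (inj₁ right) = here refl
stageNeighbours-complete {i} {j} {suc a , y} rq (inj₁ left) with (suc a , suc y) ≟² (suc i , j)
... | yes refl = ⊥-elim (ℕ.n≮n y (Region-column rq))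
... | no _     = there (here refl)
stageNeighbours-complete _ (inj₁ up) = there (there (here refl))
stageNeighbours-complete {i} {j} {a , suc y} rq (inj₁ down) with (a , suc y) ≟² (i , j)
... | yes refl = ⊥-elim (ℕ.n≮n y (Region-column rq))
... | no _     = there (there (there (here refl)))
stageNeighbours-complete {i} {suc y} _ (inj₂ diag) with (suc i , suc y) ≟² (suc i , suc y)
... | yes _      = there (here refl)
... | no ≢-refl  = ⊥-elim (≢-refl refl)
stageNeighbours-complete {i} {suc y} _ (inj₂ diag⁻) with (i , suc y) ≟² (i , suc y)
... | yes _      = there (there (there (here refl)))
... | no ≢-refl  = ⊥-elim (≢-refl refl)

StageAlive : ℕ → ℕ → ℕ → ℕ → Cell → Set
StageAlive n m i j (a , y) = Region i j (a , y) × a < n × y < m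

stage : (n m i j : ℕ) → Host 4
stage n m i j = record
  { Vertex   = Cell
  ; Alive    = StageAlive n m i j
  ; Adjacent = StageAdjacent i j
  ; bounded  = record
    { Code = Cell ; _≟ᶜ_ = _≟²_ ; code = id ; code-injective = id
    ; neighbours = stageNeighbours i j ; neighbours-length = λ _ → ℕ.≤-refl
    ; neighbours-complete = λ _ q-alive → stageNeighbours-complete (proj₁ q-alive) } }

mergeCell : ℕ → ℕ → Cell → Cell
mergeCell i j p with p ≟² (i , j)
... | yes _ = (suc i , j)
... | no _  = p

module _ {i j : ℕ} where

  Region-grows : ∀ {p} → p ≢ (i , j) → Region i j p → Region i (suc j) p
  Region-grows _ (inj₁ (y<j , i<a)) = inj₁ (ℕ.m<n⇒m<1+n y<j , i<a)
  Region-grows p≢ij (inj₂ (j≤y , i≤a)) with ℕ.m≤n⇒m<n∨m≡n j≤y | ℕ.m≤n⇒m<n∨m≡n i≤a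
  ... | inj₁ j<y  | _         = inj₂ (j<y , i≤a)
  ... | inj₂ refl | inj₁ i<a  = inj₁ (ℕ.n<1+n j , i<a)
  ... | inj₂ refl | inj₂ refl = ⊥-elim (p≢ij refl)

  mergeCell-alive : ∀ {n m p} → suc i < n → StageAlive n m i j p →
    StageAlive n m i (suc j) (mergeCell i j p)
  mergeCell-alive {p = p} si<n (rp , a<n , y<m) with p ≟² (i , j)
  ... | yes refl = inj₁ (ℕ.n<1+n j , ℕ.n<1+n i) , si<n , y<m
  ... | no p≢ij  = Region-grows p≢ij rp , a<n , y<m

  adjacent-to-merged : ∀ {q} → Region i j q → StageAdjacent i j (i , j) q →
    StageAdjacent i (suc j) (suc i , j) q ⊎ (suc i , j) ≡ q
  adjacent-to-merged _  (inj₁ right)  = inj₂ refl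
  adjacent-to-merged rq (inj₁ left)   = ⊥-elim (ℕ.n≮n _ (Region⇒≤ rq))
  adjacent-to-merged _  (inj₁ up)     = inj₁ (inj₂ diag)
  adjacent-to-merged rq (inj₁ down)   = ⊥-elim (ℕ.n≮n _ (Region-column rq))
  adjacent-to-merged _  (inj₂ diag⁻)  = inj₁ (inj₁ down)

  adjacent-away : ∀ {p q} → p ≢ (i , j) → q ≢ (i , j) →
    StageAdjacent i j p q → StageAdjacent i (suc j) p q
  adjacent-away _   _   (inj₁ pq)    = inj₁ pq
  adjacent-away _   q≢  (inj₂ diag)  = ⊥-elim (q≢ refl)
  adjacent-away p≢  _   (inj₂ diag⁻) = ⊥-elim (p≢ refl)

  mergeCell-adjacent : ∀ {p q} → Region i j p → Region i j q → StageAdjacent i j p q →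
    StageAdjacent i (suc j) (mergeCell i j p) (mergeCell i j q) ⊎ mergeCell i j p ≡ mergeCell i j q
  mergeCell-adjacent {p} {q} rp rq pq with p ≟² (i , j) | q ≟² (i , j)
  ... | yes refl | yes refl = inj₂ refl
  ... | yes refl | no _     = adjacent-to-merged rq pq
  ... | no _     | yes refl = Sum.map StageAdjacent-sym sym (adjacent-to-merged rp (StageAdjacent-sym pq))
  ... | no p≢    | no q≢    = inj₁ (adjacent-away p≢ q≢ pq)

  mergeCell-merges : ∀ {p q} → p ≢ q → mergeCell i j p ≡ mergeCell i j q →
    SamePair p q (i , j) (suc i , j)
  mergeCell-merges {p} {q} p≢q eq with p ≟² (i , j) | q ≟² (i , j)
  ... | yes refl | yes refl = ⊥-elim (p≢q refl)
  ... | yes refl | no _     = inj₁ (refl , sym eq)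
  ... | no _     | yes refl = inj₂ (eq , refl)
  ... | no _     | no _     = ⊥-elim (p≢q eq)

mergeColumnCell : ∀ {n m i j} → suc i < n → Folding (stage n m i j) (stage n m i (suc j))
mergeColumnCell si<n = record
  { fold          = mergeCell _ _
  ; fold-alive    = mergeCell-alive si<n
  ; fold-adjacent = λ pa qa → mergeCell-adjacent (proj₁ pa) (proj₁ qa)
  ; fold-merges-at-most-one-pair = λ _ _ _ _ a≢b ab c≢e ce →
      SamePair-via (mergeCell-merges a≢b ab) (mergeCell-merges c≢e ce) }

nextColumn : ∀ {n m i} → Folding (stage n m i m) (stage n m (suc i) 0)
nextColumn {n} {m} {i} = record
  { fold          = id
  ; fold-alive    = alive
  ; fold-adjacent = λ pa qa → inj₁ ∘ adjacent pa qa
  ; fold-merges-at-most-one-pair = λ _ _ _ _ a≢b ab → ⊥-elim (a≢b ab) }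
  where
  alive : ∀ {p} → StageAlive n m i m p → StageAlive n m (suc i) 0 p
  alive (inj₁ (_ , i<a) , a<n , y<m) = inj₂ (z≤n , i<a) , a<n , y<m
  alive (inj₂ (m≤y , _) , _   , y<m) = ⊥-elim (ℕ.<⇒≱ y<m m≤y)

  adjacent : ∀ {p q} → StageAlive n m i m p → StageAlive n m i m q →
    StageAdjacent i m p q → StageAdjacent (suc i) 0 p q
  adjacent _ _ (inj₁ pq) = inj₁ pq
  adjacent _ (_ , _ , y<m) (inj₂ diag)  = ⊥-elim (ℕ.n≮n _ y<m)
  adjacent (_ , _ , y<m) _ (inj₂ diag⁻) = ⊥-elim (ℕ.n≮n _ y<m)

pred≤∧<⇒≡pred : ∀ {n a} → pred n ≤ a → a < n → a ≡ pred n
pred≤∧<⇒≡pred {suc n} pred≤a (s≤s a≤n) = ℕ.≤-antisym a≤n pred≤a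

transpose : ∀ {n m} → Folding (stage n m (pred n) 0) (stage m 1 0 0)
transpose {n} {m} = record
  { fold          = toRow
  ; fold-alive    = λ { (_ , _ , y<m) → inj₂ (z≤n , z≤n) , y<m , s≤s z≤n }
  ; fold-adjacent = λ pa qa → inj₁ ∘ adjacent pa qa
  ; fold-merges-at-most-one-pair = λ pa qa _ _ a≢b ab → ⊥-elim (a≢b (injective pa qa ab)) }
  where
  toRow : Cell → Cell
  toRow (a , y) = (y , 0)

  column : ∀ {a y} → StageAlive n m (pred n) 0 (a , y) → a ≡ pred n
  column (ra , a<n , _) = pred≤∧<⇒≡pred (Region⇒≤ ra) a<n

  injective : ∀ {p q} → StageAlive n m (pred n) 0 p → StageAlive n m (pred n) 0 q →
    toRow p ≡ toRow q → p ≡ q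
  injective pa qa refl = cong (_, _) (trans (column pa) (sym (column qa)))

  adjacent : ∀ {p q} → StageAlive n m (pred n) 0 p → StageAlive n m (pred n) 0 q →
    StageAdjacent (pred n) 0 p q → StageAdjacent 0 0 (toRow p) (toRow q)
  adjacent pa qa (inj₁ right) = ⊥-elim (ℕ.1+n≢n (trans (column qa) (sym (column pa))))
  adjacent pa qa (inj₁ left)  = ⊥-elim (ℕ.1+n≢n (trans (column pa) (sym (column qa))))
  adjacent _  _  (inj₁ up)    = inj₁ right
  adjacent _  _  (inj₁ down)  = inj₁ left

rowsSequence : ∀ {n m i} → suc i < n → FoldingSequence (stage n m (suc i) 0) →
  ∀ {j} → j ≤ m → FoldingSequence (stage n m i j)
rowsSequence {n} {m} {i} si<n rest =
  descend (FoldingSequence ∘ stage n m i) (nextColumn ∷ rest) (λ _ → mergeColumnCell si<n ∷_)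

columnsSequence : ∀ {n m} → FoldingSequence (stage n m (pred n) 0) →
  ∀ {i} → i ≤ pred n → FoldingSequence (stage n m i 0)
columnsSequence {n} {m} final =
  descend (λ i → FoldingSequence (stage n m i 0)) final
    (λ i<pred rest → rowsSequence (ℕ.pred-cancel-< i<pred) rest z≤n)

gridSequence : ∀ n m → FoldingSequence (stage n m 0 0)
gridSequence n m = columnsSequence (transpose ∷ columnsSequence (end single) z≤n) z≤n
  where
  single : ∀ {p q} → StageAlive m 1 (pred m) 0 p → StageAlive m 1 (pred m) 0 q → p ≡ q
  single (ra , a<m , s≤s z≤n) (rb , b<m , s≤s z≤n) =
    cong (_, 0) (trans (pred≤∧<⇒≡pred (Region⇒≤ ra) a<m)
                       (sym (pred≤∧<⇒≡pred (Region⇒≤ rb) b<m)))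

module _ {n m : ℕ} {H : Graph} (sub : Subgraph H (grid n m)) where
  open Subgraph sub

  private
    cell : V H → Cell
    cell h = toℕ (proj₁ (ι h)) , toℕ (proj₂ (ι h))

    cell-injective : ∀ {a b} → cell a ≡ cell b → a ≡ b
    cell-injective {a} {b} eq =
      ι-inj a b (cong₂ _,_ (Fin.toℕ-injective (cong proj₁ eq)) (Fin.toℕ-injective (cong proj₂ eq)))

    cell-adjacent : ∀ {a b} → E H a b → GridAdjacent (cell a) (cell b)
    cell-adjacent {a} {b} ab with ι a | ι b | ι-E ab
    ... | x , y | x′ , y′ | inj₁ (x′≡1+x , refl) =
      subst (λ c → GridAdjacent (toℕ x , toℕ y) (c , toℕ y)) (sym x′≡1+x) right
    ... | x , y | x′ , y′ | inj₂ (inj₁ (x≡1+x′ , refl)) =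
      subst (λ c → GridAdjacent (c , toℕ y) (toℕ x′ , toℕ y)) (sym x≡1+x′) left
    ... | x , y | x′ , y′ | inj₂ (inj₂ (inj₁ (refl , y′≡1+y))) =
      subst (λ c → GridAdjacent (toℕ x , toℕ y) (toℕ x , c)) (sym y′≡1+y) up
    ... | x , y | x′ , y′ | inj₂ (inj₂ (inj₂ (refl , y≡1+y′))) =
      subst (λ c → GridAdjacent (toℕ x , c) (toℕ x , toℕ y′)) (sym y≡1+y′) down

  subgridBound : BoundedDegree 4 (λ _ → ⊤) (E H)
  subgridBound = record
    { Code = Cell ; _≟ᶜ_ = _≟²_ ; code = cell ; code-injective = cell-injective
    ; neighbours = gridNeighbours ∘ cell ; neighbours-length = λ _ → ℕ.≤-refl
    ; neighbours-complete = λ _ _ → gridNeighbours-complete ∘ cell-adjacent }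

  subgridInclusion : Folding (graphHost H subgridBound) (stage n m 0 0)
  subgridInclusion = record
    { fold          = cell
    ; fold-alive    = λ {h} _ →
        inj₂ (z≤n , z≤n) , Fin.toℕ<n (proj₁ (ι h)) , Fin.toℕ<n (proj₂ (ι h))
    ; fold-adjacent = λ _ _ → inj₁ ∘ inj₁ ∘ cell-adjacent
    ; fold-merges-at-most-one-pair = λ _ _ _ _ a≢b ab → ⊥-elim (a≢b (cell-injective ab)) }

isoEmbedding : ∀ {d k} {G : Trigraph k} {S : Graph} {bound : BoundedDegree d (λ _ → ⊤) (E S)} →
  Iso (totalGraph G) S → Embedding (graphHost S bound) G
isoEmbedding iso = record
  { embed     = to
  ; alive     = λ _ → tt
  ; injective = Injection.injective (↔⇒↣ bij)
  ; adjacent  = to-E }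
  where open Iso iso

lemma10 : (k : ℕ) (G : Trigraph k) →
    SubdivOfSubgraphOfGrid (totalGraph G) → TwinWidth≤ 4 G
lemma10 k G (n , m , H , S , H⊆grid , S-subdivides-H , G≅S) =
  let _ , sequence = subdivisionSequence (s≤s (s≤s z≤n)) S-subdivides-H (subgridBound H⊆grid)
                       (subgridInclusion H⊆grid ∷ gridSequence n m)
  in dSequence sequence (isoEmbedding G≅S)
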